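{- Let $r > 2$, $n \geq 3$ and $m \geq 0$ be integers. Then $C_n^{(r)} \oplus I_m \in GR(2)$.
   Context: A $k$-colored graph $G=(V,E)$ consists of a finite set $V$ and a function $E$ from the 2-element subsets of $V$ to $\{0,\ldots,k-1\}$. An automorphism of $G$ is a permutation of $V$ preserving $E$; $Aut(G)$ is the automorphism group as a permutation group on $V$. Permutation groups are considered up to permutation isomorphism. $GR(k)$ is the class of permutation groups $(A,V)$ with $A=Aut(G)$ for some $k$-colored graph $G$ on $V$. $C_n$ denotes the regular action of $\mathbb{Z}_n$ on $n$ points. $I_m$ denotes the trivial group acting on $m$ points; $A\oplus I_0=A$. For $(A,V)$, the parallel product $A^{(r)}$ is $A$ acting on $V\times\{1,\ldots,r\}$ by $a((v,i))=(a(v),i)$. For permutation groups $(A,V)$, $(B,W)$ with disjoint domains, the direct sum $A\oplus B$ is the group of pairs $(a,b)$ acting on $V\cup W$, with $a$ acting on $V$ and $b$ on $W$. -}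

module Defs where

open import Data.Nat using (ℕ; zero; suc; _+_)
open import Data.Nat.DivMod using (_mod_)
open import Data.Fin using (Fin; toℕ)
open import Data.Product using (_×_; _,_; Σ; ∃)
open import Data.Sum using (_⊎_; inj₁; inj₂)
open import Function.Bundles using (_↔_; Inverse)
open import Relation.Binary.PropositionalEquality using (_≡_; _≢_)

Perm : Set → Set
Perm V = V ↔ V

-- A k-colored graph on V: a colour for each 2-element subset {x,y}, represented
-- as a function E : V → V → Fin k that is symmetric on distinct pairs
-- (values on the diagonal x = y are irrelevant and ignored everywhere).
record ColoredGraph (k : ℕ) (V : Set) : Set where
  field
    colour    : V → V → Fin k
    symmetric : ∀ x y → x ≢ y → colour x y ≡ colour y x

IsAut : ∀ {k V} → ColoredGraph k V → Perm V → Set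
IsAut G π = ∀ x y → x ≢ y →
  ColoredGraph.colour G (Inverse.to π x) (Inverse.to π y) ≡ ColoredGraph.colour G x y

-- A permutation group on V, given as the predicate "π belongs to the group".
-- (A, V) ∈ GR(k): there is a k-colored graph G on V with Aut(G) = A
-- (GR(k) is closed under permutation isomorphism, so we may take G on V itself).
GR : (k : ℕ) {V : Set} → (Perm V → Set) → Set
GR k {V} A = Σ (ColoredGraph k V) λ G →
  ∀ (π : Perm V) → (IsAut G π → A π) × (A π → IsAut G π)

addMod : (n : ℕ) → Fin n → Fin n → Fin n
addMod zero    k i = i
addMod (suc n) k i = (toℕ i + toℕ k) mod (suc n)

Dom : ℕ → ℕ → ℕ → Set
Dom n r m = (Fin n × Fin r) ⊎ Fin m

act : ∀ {n r m} → Fin n → Dom n r m → Dom n r m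
act {n} k (inj₁ (i , j)) = inj₁ (addMod n k i , j)
act     k (inj₂ x)       = inj₂ x

CnrIm : (n r m : ℕ) → Perm (Dom n r m) → Set
CnrIm n r m π = ∃ λ (k : Fin n) → ∀ v → Inverse.to π v ≡ act k v

module Submission where

-- Write the domain as n·r orbit points (i, j)
-- and m fixed points.  The first three layers form the rigid core
--   A i — A (i+1)   (an n-cycle),
--   B i — A i, A (i+1), C i   (B i "orients" the cycle edge from A i to A (i+1)),
--   C i — A i,
-- the remaining r-3 layers form a path T i 0 — T i 1 — … hanging off C i, and
-- the fixed points form a path P 0 — P 1 — … whose end P 0 is joined to every B i.
-- Rotations i ↦ i + k clearly preserve this graph.  Conversely, let f be an
-- automorphism.  The cycle vertices are the only "hubs" (≥ 5 distinct
-- neighbours, two of them adjacent), so f permutes them; the orientation gadget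
-- forces f (A i) = A (i + k) for a fixed k; finally agreement of f with the
-- rotation by k spreads from vertices to their unique common neighbours.

open import Defs
open import Data.Bool using (if_then_else_)
open import Data.Nat using (ℕ; suc; pred; _+_; _∸_; _<_; _≤_; z≤n; s≤s; z<s; s<s)
open import Data.Nat.Properties
  using (+-comm; +-assoc; +-identityʳ; m+[n∸m]≡n; <⇒≤; ≤-refl; n≤1+n; n≤0⇒n≡0; 1+n≢n; 0≢1+n)
  renaming (_≟_ to _≟ℕ_)
open import Data.Nat.DivMod using (_%_; _mod_; %-distribˡ-+; m%n%n≡m%n; m<n⇒m%n≡m; n%n≡0; m%n<n)
open import Data.Fin using (Fin; toℕ; _≟_) renaming (zero to fzero; suc to fsuc; _<_ to _<ᶠ_)
open import Data.Fin.Patterns using (0F; 1F; 2F; 3F; 4F)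
open import Data.Fin.Properties using (toℕ-injective; toℕ<n; toℕ-fromℕ<; pigeonhole)
import Data.Fin.Properties as Fin
open import Data.Product using (_×_; _,_; ∃; proj₁; proj₂; uncurry)
open import Data.Empty using (⊥; ⊥-elim)
open import Data.Sum using (_⊎_; inj₁; inj₂; swap)
import Data.Sum.Properties as Sum
import Data.Product.Properties as Product
open import Function using (_∘_)
open import Function.Bundles using (Inverse; mk⇔)
open import Relation.Binary.Definitions using (DecidableEquality)
open import Relation.Binary.PropositionalEquality
open import Relation.Nullary using (¬_; Dec; yes; no; does; contradiction)
open import Relation.Nullary.Decidable using (map′; _×-dec_; _⊎-dec_; dec-true; dec-false; does-⇔)

-- Course-of-values induction along 0, 1, 2, … in Fin k, with the successor
-- relation written as toℕ v ≡ suc (toℕ u), the form in which paths are given.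
path-induction : ∀ {k : ℕ} (Q : Fin k → Set) →
  (∀ v → toℕ v ≡ 0 → Q v) →
  (∀ (u v : Fin k) → toℕ v ≡ suc (toℕ u) → (∀ w → toℕ w ≤ toℕ u → Q w) → Q v) →
  ∀ v → Q v
path-induction Q base step fzero    = base fzero refl
path-induction Q base step (fsuc v) = path-induction (λ w → Q (fsuc w)) base′ step′ v
  where
  below : ∀ u → (∀ w → toℕ w ≤ toℕ u → Q (fsuc w)) → ∀ w → toℕ w ≤ suc (toℕ u) → Q w
  below u ih fzero    _         = base fzero refl
  below u ih (fsuc w) (s≤s w≤u) = ih w w≤u
  base′ : ∀ v → toℕ v ≡ 0 → Q (fsuc v)
  base′ v e = step fzero (fsuc v) (cong suc e) (λ w w≤0 → base w (n≤0⇒n≡0 w≤0))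
  step′ : ∀ u v → toℕ v ≡ suc (toℕ u) → (∀ w → toℕ w ≤ toℕ u → Q (fsuc w)) → Q (fsuc v)
  step′ u v e ih = step (fsuc u) (fsuc v) (cong suc e) (below u ih)

module ZMod (N : ℕ) where

  n : ℕ
  n = suc N

  infixl 6 _⊕_
  _⊕_ : Fin n → Fin n → Fin n
  i ⊕ k = addMod n k i

  ⊖_ : Fin n → Fin n
  ⊖ k = (n ∸ toℕ k) mod n

  toℕ-⊕ : ∀ i k → toℕ (i ⊕ k) ≡ (toℕ i + toℕ k) % n
  toℕ-⊕ i k = toℕ-fromℕ< (m%n<n (toℕ i + toℕ k) n)

  %-absorbˡ : ∀ a b → (a % n + b) % n ≡ (a + b) % n
  %-absorbˡ a b = begin
    (a % n + b) % n         ≡⟨ %-distribˡ-+ (a % n) b n ⟩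
    (a % n % n + b % n) % n ≡⟨ cong (λ x → (x + b % n) % n) (m%n%n≡m%n a n) ⟩
    (a % n + b % n) % n     ≡⟨ %-distribˡ-+ a b n ⟨
    (a + b) % n             ∎
    where open ≡-Reasoning

  %-absorbʳ : ∀ a b → (a + b % n) % n ≡ (a + b) % n
  %-absorbʳ a b = begin
    (a + b % n) % n ≡⟨ cong (_% n) (+-comm a (b % n)) ⟩
    (b % n + a) % n ≡⟨ %-absorbˡ b a ⟩
    (b + a) % n     ≡⟨ cong (_% n) (+-comm b a) ⟩
    (a + b) % n     ∎
    where open ≡-Reasoning

  ⊕-assoc : ∀ i k l → (i ⊕ k) ⊕ l ≡ i ⊕ (k ⊕ l)
  ⊕-assoc i k l = toℕ-injective (begin
    toℕ ((i ⊕ k) ⊕ l)                 ≡⟨ toℕ-⊕ (i ⊕ k) l ⟩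
    (toℕ (i ⊕ k) + toℕ l) % n         ≡⟨ cong (λ x → (x + toℕ l) % n) (toℕ-⊕ i k) ⟩
    ((toℕ i + toℕ k) % n + toℕ l) % n ≡⟨ %-absorbˡ (toℕ i + toℕ k) (toℕ l) ⟩
    (toℕ i + toℕ k + toℕ l) % n       ≡⟨ cong (_% n) (+-assoc (toℕ i) (toℕ k) (toℕ l)) ⟩
    (toℕ i + (toℕ k + toℕ l)) % n     ≡⟨ %-absorbʳ (toℕ i) (toℕ k + toℕ l) ⟨
    (toℕ i + (toℕ k + toℕ l) % n) % n ≡⟨ cong (λ x → (toℕ i + x) % n) (toℕ-⊕ k l) ⟨
    (toℕ i + toℕ (k ⊕ l)) % n         ≡⟨ toℕ-⊕ i (k ⊕ l) ⟨
    toℕ (i ⊕ (k ⊕ l))                 ∎)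
    where open ≡-Reasoning

  ⊕-comm : ∀ i k → i ⊕ k ≡ k ⊕ i
  ⊕-comm i k = toℕ-injective (begin
    toℕ (i ⊕ k)         ≡⟨ toℕ-⊕ i k ⟩
    (toℕ i + toℕ k) % n ≡⟨ cong (_% n) (+-comm (toℕ i) (toℕ k)) ⟩
    (toℕ k + toℕ i) % n ≡⟨ toℕ-⊕ k i ⟨
    toℕ (k ⊕ i)         ∎)
    where open ≡-Reasoning

  ⊕-identityʳ : ∀ i → i ⊕ 0F ≡ i
  ⊕-identityʳ i = toℕ-injective (begin
    toℕ (i ⊕ 0F)    ≡⟨ toℕ-⊕ i 0F ⟩
    (toℕ i + 0) % n ≡⟨ cong (_% n) (+-identityʳ (toℕ i)) ⟩
    toℕ i % n       ≡⟨ m<n⇒m%n≡m (toℕ<n i) ⟩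
    toℕ i           ∎)
    where open ≡-Reasoning

  ⊕-identityˡ : ∀ i → 0F ⊕ i ≡ i
  ⊕-identityˡ i = trans (⊕-comm 0F i) (⊕-identityʳ i)

  ⊕-inverseʳ : ∀ k → k ⊕ ⊖ k ≡ 0F
  ⊕-inverseʳ k = toℕ-injective (begin
    toℕ (k ⊕ ⊖ k)                 ≡⟨ toℕ-⊕ k (⊖ k) ⟩
    (toℕ k + toℕ (⊖ k)) % n       ≡⟨ cong (λ x → (toℕ k + x) % n) (toℕ-fromℕ< (m%n<n (n ∸ toℕ k) n)) ⟩
    (toℕ k + (n ∸ toℕ k) % n) % n ≡⟨ %-absorbʳ (toℕ k) (n ∸ toℕ k) ⟩
    (toℕ k + (n ∸ toℕ k)) % n     ≡⟨ cong (_% n) (m+[n∸m]≡n (<⇒≤ (toℕ<n k))) ⟩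
    n % n                         ≡⟨ n%n≡0 n ⟩
    0                             ∎)
    where open ≡-Reasoning

  ⊕-cancel : ∀ i k → (i ⊕ k) ⊕ ⊖ k ≡ i
  ⊕-cancel i k = begin
    (i ⊕ k) ⊕ ⊖ k ≡⟨ ⊕-assoc i k (⊖ k) ⟩
    i ⊕ (k ⊕ ⊖ k) ≡⟨ cong (i ⊕_) (⊕-inverseʳ k) ⟩
    i ⊕ 0F        ≡⟨ ⊕-identityʳ i ⟩
    i             ∎
    where open ≡-Reasoning

  ⊖-cancel : ∀ i k → (i ⊕ ⊖ k) ⊕ k ≡ i
  ⊖-cancel i k = begin
    (i ⊕ ⊖ k) ⊕ k ≡⟨ ⊕-assoc i (⊖ k) k ⟩
    i ⊕ (⊖ k ⊕ k) ≡⟨ cong (i ⊕_) (trans (⊕-comm (⊖ k) k) (⊕-inverseʳ k)) ⟩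
    i ⊕ 0F        ≡⟨ ⊕-identityʳ i ⟩
    i             ∎
    where open ≡-Reasoning

  ⊕-injective : ∀ {i j} k → i ⊕ k ≡ j ⊕ k → i ≡ j
  ⊕-injective {i} {j} k e = trans (sym (⊕-cancel i k)) (trans (cong (_⊕ ⊖ k) e) (⊕-cancel j k))

  ⊕-free : ∀ i k → i ⊕ k ≡ i → k ≡ 0F
  ⊕-free i k e = ⊕-injective i (trans (⊕-comm k i) (trans e (sym (⊕-identityˡ i))))

module AdjacencyGraph {V : Set} (Adj : V → V → Set)
    (adj? : ∀ x y → Dec (Adj x y))
    (adj-sym : ∀ {x y} → Adj x y → Adj y x)
    (adj-irrefl : ∀ {x} → ¬ Adj x x) where

  colour : V → V → Fin 2
  colour x y = if does (adj? x y) then 1F else 0F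

  adj⇒colour : ∀ {x y} → Adj x y → colour x y ≡ 1F
  adj⇒colour {x} {y} a = cong (if_then 1F else 0F) (dec-true (adj? x y) a)

  colour⇒adj : ∀ {x y} → colour x y ≡ 1F → Adj x y
  colour⇒adj {x} {y} c with adj? x y
  ... | yes a = a
  ... | no  _ = contradiction c λ ()

  colour-cong : ∀ {x y x′ y′} → (Adj x y → Adj x′ y′) → (Adj x′ y′ → Adj x y) →
                colour x y ≡ colour x′ y′
  colour-cong {x} {y} {x′} {y′} to from =
    cong (if_then 1F else 0F) (does-⇔ (mk⇔ to from) (adj? x y) (adj? x′ y′))

  graph : ColoredGraph 2 V
  graph = record { colour = colour ; symmetric = λ _ _ _ → colour-cong adj-sym adj-sym }

  colour-invariant : (h : V → V) →
    (∀ {x y} → Adj x y → Adj (h x) (h y)) → (∀ {x y} → Adj (h x) (h y) → Adj x y) →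
    ∀ x y → colour (h x) (h y) ≡ colour x y
  colour-invariant h preserves reflects x y = colour-cong reflects preserves

  record Hub (x : V) : Set where
    field
      nbr      : Fin 5 → V
      nbr-inj  : ∀ {a b} → nbr a ≡ nbr b → a ≡ b
      nbr-adj  : ∀ a → Adj x (nbr a)
      triangle : Adj (nbr 0F) (nbr 1F)

  hub-map : (h : V → V) → (∀ {x y} → h x ≡ h y → x ≡ y) →
            (∀ {x y} → Adj x y → Adj (h x) (h y)) → ∀ {x} → Hub x → Hub (h x)
  hub-map h h-inj h-adj hub = record
    { nbr      = h ∘ nbr
    ; nbr-inj  = nbr-inj ∘ h-inj
    ; nbr-adj  = h-adj ∘ nbr-adj
    ; triangle = h-adj triangle }
    where open Hub hub

  few-neighbours⇒¬hub : ∀ {x k} → k < 5 → (Class : Fin k → V → Set) →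
    (∀ l {y y′} → Class l y → Class l y′ → y ≡ y′) →
    (∀ {y} → Adj x y → ∃ λ l → Class l y) → ¬ Hub x
  few-neighbours⇒¬hub k<5 Class unique classify hub = collision (pigeonhole k<5 (proj₁ ∘ label))
    where
    open Hub hub
    label : ∀ a → ∃ λ l → Class l (nbr a)
    label a = classify (nbr-adj a)
    collision : (∃ λ a → ∃ λ b → a <ᶠ b × proj₁ (label a) ≡ proj₁ (label b)) → ⊥
    collision (a , b , a<b , same) = Fin.<⇒≢ a<b
      (nbr-inj (unique _ (subst (λ l → Class l (nbr a)) same (proj₂ (label a))) (proj₂ (label b))))

  record Oriented (x y : V) : Set where
    field
      apex      : V
      apex-x    : Adj apex x
      apex-y    : Adj apex y
      apex-¬hub : ¬ Hub apex
      wing      : V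
      wing-x    : Adj wing x
      wing-apex : Adj wing apex
      wing≢y    : wing ≢ y

  module Automorphism (π : Perm V) (aut : IsAut graph π) where

    f f⁻¹ : V → V
    f   = Inverse.to π
    f⁻¹ = Inverse.from π

    f-f⁻¹ : ∀ x → f (f⁻¹ x) ≡ x
    f-f⁻¹ = Inverse.strictlyInverseˡ π

    f⁻¹-f : ∀ x → f⁻¹ (f x) ≡ x
    f⁻¹-f = Inverse.strictlyInverseʳ π

    f-injective : ∀ {x y} → f x ≡ f y → x ≡ y
    f-injective {x} {y} e = trans (sym (f⁻¹-f x)) (trans (cong f⁻¹ e) (f⁻¹-f y))

    f⁻¹-injective : ∀ {x y} → f⁻¹ x ≡ f⁻¹ y → x ≡ y
    f⁻¹-injective {x} {y} e = trans (sym (f-f⁻¹ x)) (trans (cong f e) (f-f⁻¹ y))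

    preserves : ∀ {x y} → Adj x y → Adj (f x) (f y)
    preserves {x} {y} a = colour⇒adj (trans (aut x y λ { refl → adj-irrefl a }) (adj⇒colour a))

    reflects : ∀ {x y} → Adj (f x) (f y) → Adj x y
    reflects {x} {y} a = colour⇒adj (trans (sym (aut x y λ { refl → adj-irrefl a })) (adj⇒colour a))

    preserves⁻¹ : ∀ {x y} → Adj x y → Adj (f⁻¹ x) (f⁻¹ y)
    preserves⁻¹ {x} {y} a = reflects (subst₂ Adj (sym (f-f⁻¹ x)) (sym (f-f⁻¹ y)) a)

    hub-f : ∀ {x} → Hub x → Hub (f x)
    hub-f = hub-map f f-injective preserves

    ¬hub-f : ∀ {x} → ¬ Hub x → ¬ Hub (f x)
    ¬hub-f {x} ¬hub hub = ¬hub (subst Hub (f⁻¹-f x) (hub-map f⁻¹ f⁻¹-injective preserves⁻¹ hub))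

    oriented-f : ∀ {x y} → Oriented x y → Oriented (f x) (f y)
    oriented-f o = record
      { apex = f apex ; apex-x = preserves apex-x ; apex-y = preserves apex-y
      ; apex-¬hub = ¬hub-f apex-¬hub
      ; wing = f wing ; wing-x = preserves wing-x ; wing-apex = preserves wing-apex
      ; wing≢y = wing≢y ∘ f-injective }
      where open Oriented o

    -- Compare f with a bijection h that reflects adjacency.  If they agree on
    -- two neighbours u₁, u₂ of v and on every other common neighbour of u₁ and
    -- u₂, they agree on v: the vertex h⁻¹ (f v) is such a common neighbour.
    module Agreement (_≟_ : DecidableEquality V) (h h⁻¹ : V → V)
        (h-reflects : ∀ {x y} → Adj (h x) (h y) → Adj x y)
        (h-h⁻¹ : ∀ w → h (h⁻¹ w) ≡ w) where

      Agrees : V → Set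
      Agrees v = f v ≡ h v

      spread : ∀ {u₁ u₂ v} → Agrees u₁ → Agrees u₂ → Adj u₁ v → Adj u₂ v →
               (∀ {x} → Adj u₁ x → Adj u₂ x → x ≢ v → Agrees x) → Agrees v
      spread {v = v} ag₁ ag₂ a₁ a₂ others with h⁻¹ (f v) ≟ v
      ... | yes x≡v = trans (sym (h-h⁻¹ (f v))) (cong h x≡v)
      ... | no  x≢v = contradiction (f-injective f-x≡f-v) x≢v
        where
        towards : ∀ {u} → Agrees u → Adj u v → Adj u (h⁻¹ (f v))
        towards ag a = h-reflects (subst₂ Adj ag (sym (h-h⁻¹ (f v))) (preserves a))
        f-x≡f-v : f (h⁻¹ (f v)) ≡ f v
        f-x≡f-v = trans (others (towards ag₁ a₁) (towards ag₂ a₂) x≢v) (h-h⁻¹ (f v))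

      spread₁ : ∀ {u v} → Agrees u → Adj u v → (∀ {x} → Adj u x → x ≢ v → Agrees x) → Agrees v
      spread₁ ag a others = spread ag ag a a (λ a′ _ → others a′)

module Construction (n′ r′ m : ℕ) where

  open ZMod (suc (suc n′)) public

  R : ℕ
  R = suc (suc (suc r′))

  V : Set
  V = Dom n R m

  pattern A i   = inj₁ (i , 0F)
  pattern B i   = inj₁ (i , 1F)
  pattern C i   = inj₁ (i , 2F)
  pattern T i u = inj₁ (i , fsuc (fsuc (fsuc u)))
  pattern P x   = inj₂ x

  _≟V_ : DecidableEquality V
  _≟V_ = Sum.≡-dec (Product.≡-dec _≟_ _≟_) _≟_

  s p : Fin n → Fin n
  s i = i ⊕ 1F
  p i = i ⊕ ⊖ 1F

  s-p : ∀ i → s (p i) ≡ i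
  s-p i = ⊖-cancel i 1F

  s-⊕ : ∀ i k → s (i ⊕ k) ≡ s i ⊕ k
  s-⊕ i k = begin
    (i ⊕ k) ⊕ 1F ≡⟨ ⊕-assoc i k 1F ⟩
    i ⊕ (k ⊕ 1F) ≡⟨ cong (i ⊕_) (⊕-comm k 1F) ⟩
    i ⊕ (1F ⊕ k) ≡⟨ ⊕-assoc i 1F k ⟨
    (i ⊕ 1F) ⊕ k ∎
    where open ≡-Reasoning

  -- Because n ≥ 3, the cycle has no loops and no 2-cycles.
  s-irrefl : ∀ i → s i ≢ i
  s-irrefl i e with () ← ⊕-free i 1F e

  ss-irrefl : ∀ i → s (s i) ≢ i
  ss-irrefl i e with () ← ⊕-free i 2F (trans (sym (⊕-assoc i 1F 1F)) e)

  s-from-toℕ : ∀ {u v} → toℕ v ≡ suc (toℕ u) → s u ≡ v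
  s-from-toℕ {u} {v} e = toℕ-injective (begin
    toℕ (u ⊕ 1F)    ≡⟨ toℕ-⊕ u 1F ⟩
    (toℕ u + 1) % n ≡⟨ cong (_% n) (trans (+-comm (toℕ u) 1) (sym e)) ⟩
    toℕ v % n       ≡⟨ m<n⇒m%n≡m (toℕ<n v) ⟩
    toℕ v           ∎)
    where open ≡-Reasoning

  cycle-induction : (Q : Fin n → Set) → Q 0F → (∀ i → Q i → Q (s i)) → ∀ i → Q i
  cycle-induction Q q₀ step = path-induction Q
    (λ v e → subst Q (toℕ-injective (sym e)) q₀)
    (λ u v e ih → subst Q (s-from-toℕ e) (step u (ih u ≤-refl)))

  -- The edges, each listed once; a constructor is named after the layers of
  -- its endpoints (aa: cycle, ab/ba/bc: orientation triangles, ac: marker,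
  -- ct/tt: tails, bp/pp: the fixed path).
  data Edge : V → V → Set where
    aa : ∀ {i j} → s i ≡ j → Edge (A i) (A j)
    ab : ∀ {i j} → i ≡ j → Edge (A i) (B j)
    ba : ∀ {i j} → s i ≡ j → Edge (B i) (A j)
    ac : ∀ {i j} → i ≡ j → Edge (A i) (C j)
    bc : ∀ {i j} → i ≡ j → Edge (B i) (C j)
    ct : ∀ {i j u} → i ≡ j → toℕ u ≡ 0 → Edge (C i) (T j u)
    tt : ∀ {i j u v} → i ≡ j → toℕ v ≡ suc (toℕ u) → Edge (T i u) (T j v)
    bp : ∀ {i x} → toℕ x ≡ 0 → Edge (B i) (P x)
    pp : ∀ {x y} → toℕ y ≡ suc (toℕ x) → Edge (P x) (P y)

  Adj : V → V → Set
  Adj x y = Edge x y ⊎ Edge y x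

  edge? : ∀ x y → Dec (Edge x y)
  edge? (A i)   (A j)   = map′ aa (λ { (aa e) → e }) (s i ≟ j)
  edge? (A i)   (B j)   = map′ ab (λ { (ab e) → e }) (i ≟ j)
  edge? (A i)   (C j)   = map′ ac (λ { (ac e) → e }) (i ≟ j)
  edge? (A i)   (T j u) = no λ ()
  edge? (A i)   (P x)   = no λ ()
  edge? (B i)   (A j)   = map′ ba (λ { (ba e) → e }) (s i ≟ j)
  edge? (B i)   (B j)   = no λ ()
  edge? (B i)   (C j)   = map′ bc (λ { (bc e) → e }) (i ≟ j)
  edge? (B i)   (T j u) = no λ ()
  edge? (B i)   (P x)   = map′ bp (λ { (bp e) → e }) (toℕ x ≟ℕ 0)
  edge? (C i)   (A j)   = no λ ()
  edge? (C i)   (B j)   = no λ ()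
  edge? (C i)   (C j)   = no λ ()
  edge? (C i)   (T j u) = map′ (uncurry ct) (λ { (ct e e′) → e , e′ }) ((i ≟ j) ×-dec (toℕ u ≟ℕ 0))
  edge? (C i)   (P x)   = no λ ()
  edge? (T i u) (A j)   = no λ ()
  edge? (T i u) (B j)   = no λ ()
  edge? (T i u) (C j)   = no λ ()
  edge? (T i u) (T j v) =
    map′ (uncurry tt) (λ { (tt e e′) → e , e′ }) ((i ≟ j) ×-dec (toℕ v ≟ℕ suc (toℕ u)))
  edge? (T i u) (P x)   = no λ ()
  edge? (P x)   (A j)   = no λ ()
  edge? (P x)   (B j)   = no λ ()
  edge? (P x)   (C j)   = no λ ()
  edge? (P x)   (T j u) = no λ ()
  edge? (P x)   (P y)   = map′ pp (λ { (pp e) → e }) (toℕ y ≟ℕ suc (toℕ x))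

  edge-irrefl : ∀ {x} → ¬ Edge x x
  edge-irrefl (aa e)   = s-irrefl _ e
  edge-irrefl (tt _ e) = 1+n≢n (sym e)
  edge-irrefl (pp e)   = 1+n≢n (sym e)

  adj? : ∀ x y → Dec (Adj x y)
  adj? x y = edge? x y ⊎-dec edge? y x

  adj-irrefl : ∀ {x} → ¬ Adj x x
  adj-irrefl (inj₁ e) = edge-irrefl e
  adj-irrefl (inj₂ e) = edge-irrefl e

  open AdjacencyGraph Adj adj? swap adj-irrefl public

  rot : Fin n → V → V
  rot k = act k

  rot-edge : ∀ k {x y} → Edge x y → Edge (rot k x) (rot k y)
  rot-edge k (aa {i} e) = aa (trans (s-⊕ i k) (cong (_⊕ k) e))
  rot-edge k (ab e)     = ab (cong (_⊕ k) e)
  rot-edge k (ba {i} e) = ba (trans (s-⊕ i k) (cong (_⊕ k) e))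
  rot-edge k (ac e)     = ac (cong (_⊕ k) e)
  rot-edge k (bc e)     = bc (cong (_⊕ k) e)
  rot-edge k (ct e e′)  = ct (cong (_⊕ k) e) e′
  rot-edge k (tt e e′)  = tt (cong (_⊕ k) e) e′
  rot-edge k (bp e)     = bp e
  rot-edge k (pp e)     = pp e

  rot-adj : ∀ k {x y} → Adj x y → Adj (rot k x) (rot k y)
  rot-adj k (inj₁ e) = inj₁ (rot-edge k e)
  rot-adj k (inj₂ e) = inj₂ (rot-edge k e)

  rot-cancel : ∀ k w → rot (⊖ k) (rot k w) ≡ w
  rot-cancel k (inj₁ (i , j)) = cong (λ z → inj₁ (z , j)) (⊕-cancel i k)
  rot-cancel k (inj₂ x)       = refl

  rot⁻¹-cancel : ∀ k w → rot k (rot (⊖ k) w) ≡ w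
  rot⁻¹-cancel k (inj₁ (i , j)) = cong (λ z → inj₁ (z , j)) (⊖-cancel i k)
  rot⁻¹-cancel k (inj₂ x)       = refl

  rot-reflects : ∀ k {x y} → Adj (rot k x) (rot k y) → Adj x y
  rot-reflects k {x} {y} a = subst₂ Adj (rot-cancel k x) (rot-cancel k y) (rot-adj (⊖ k) a)

  rotation⇒aut : ∀ π → CnrIm n R m π → IsAut graph π
  rotation⇒aut π (k , π≡rot) x y _ =
    trans (cong₂ colour (π≡rot x) (π≡rot y)) (colour-invariant (rot k) (rot-adj k) (rot-reflects k) x y)

  -- The cycle vertices are hubs: A j has neighbours B j, C j (adjacent to each
  -- other), A (s j), A (p j) and B (p j).  The map slot j tells them apart.
  hub-nbr : Fin n → Fin 5 → V
  hub-nbr j 0F = B j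
  hub-nbr j 1F = C j
  hub-nbr j 2F = A (s j)
  hub-nbr j 3F = A (p j)
  hub-nbr j 4F = B (p j)

  slot : Fin n → V → Fin 5
  slot j (A i) = if does (i ≟ s j) then 2F else 3F
  slot j (B i) = if does (i ≟ j) then 0F else 4F
  slot j _     = 1F

  slot-hub-nbr : ∀ j a → slot j (hub-nbr j a) ≡ a
  slot-hub-nbr j 0F = cong (if_then 0F else 4F) (dec-true (j ≟ j) refl)
  slot-hub-nbr j 1F = refl
  slot-hub-nbr j 2F = cong (if_then 2F else 3F) (dec-true (s j ≟ s j) refl)
  slot-hub-nbr j 3F = cong (if_then 2F else 3F) (dec-false (p j ≟ s j) p≢s)
    where
    p≢s : p j ≢ s j
    p≢s e = ss-irrefl j (trans (cong s (sym e)) (s-p j))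
  slot-hub-nbr j 4F = cong (if_then 0F else 4F) (dec-false (p j ≟ j) p≢id)
    where
    p≢id : p j ≢ j
    p≢id e = s-irrefl j (trans (cong s (sym e)) (s-p j))

  hub-A : ∀ j → Hub (A j)
  hub-A j = record
    { nbr      = hub-nbr j
    ; nbr-inj  = λ {a} {b} e →
        trans (sym (slot-hub-nbr j a)) (trans (cong (slot j) e) (slot-hub-nbr j b))
    ; nbr-adj  = λ { 0F → inj₁ (ab refl) ; 1F → inj₁ (ac refl) ; 2F → inj₁ (aa refl)
                   ; 3F → inj₂ (aa (s-p j)) ; 4F → inj₂ (ba (s-p j)) }
    ; triangle = inj₁ (bc refl) }

  -- Neighbour classes with at most one member: the vertex at position t on the
  -- tail below C j, the fixed point at position t, and a single given vertex.
  TailAt : Fin n → ℕ → V → Set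
  TailAt j t y = ∃ λ u → y ≡ T j u × toℕ u ≡ t

  PathAt : ℕ → V → Set
  PathAt t y = ∃ λ x → y ≡ P x × toℕ x ≡ t

  tailAt-unique : ∀ {j t y y′} → TailAt j t y → TailAt j t y′ → y ≡ y′
  tailAt-unique {j} (u , refl , e) (u′ , refl , e′) = cong (T j) (toℕ-injective (trans e (sym e′)))

  pathAt-unique : ∀ {t y y′} → PathAt t y → PathAt t y′ → y ≡ y′
  pathAt-unique (x , refl , e) (x′ , refl , e′) = cong P (toℕ-injective (trans e (sym e′)))

  ≡-unique : ∀ {c y y′ : V} → y ≡ c → y′ ≡ c → y ≡ y′
  ≡-unique e e′ = trans e (sym e′)

  -- No other vertex is a hub.  B j, C j, T j u and P x (x ≠ 0) have at most four
  -- neighbours; the neighbours of P 0 (the B's and P 1) are pairwise non-adjacent.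
  ¬hub-B : ∀ j → ¬ Hub (B j)
  ¬hub-B j = few-neighbours⇒¬hub (s<s (s<s (s<s (s<s z<s)))) Class unique classify
    where
    Class : Fin 4 → V → Set
    Class 0F y = y ≡ A j
    Class 1F y = y ≡ A (s j)
    Class 2F y = y ≡ C j
    Class 3F y = PathAt 0 y
    unique : ∀ l {y y′} → Class l y → Class l y′ → y ≡ y′
    unique 0F = ≡-unique
    unique 1F = ≡-unique
    unique 2F = ≡-unique
    unique 3F = pathAt-unique
    classify : ∀ {y} → Adj (B j) y → ∃ λ l → Class l y
    classify (inj₂ (ab e)) = 0F , cong A e
    classify (inj₁ (ba e)) = 1F , cong A (sym e)
    classify (inj₁ (bc e)) = 2F , cong C (sym e)
    classify (inj₁ (bp e)) = 3F , _ , refl , e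

  ¬hub-C : ∀ j → ¬ Hub (C j)
  ¬hub-C j = few-neighbours⇒¬hub (s<s (s<s (s<s z<s))) Class unique classify
    where
    Class : Fin 3 → V → Set
    Class 0F y = y ≡ A j
    Class 1F y = y ≡ B j
    Class 2F y = TailAt j 0 y
    unique : ∀ l {y y′} → Class l y → Class l y′ → y ≡ y′
    unique 0F = ≡-unique
    unique 1F = ≡-unique
    unique 2F = tailAt-unique
    classify : ∀ {y} → Adj (C j) y → ∃ λ l → Class l y
    classify (inj₂ (ac e))      = 0F , cong A e
    classify (inj₂ (bc e))      = 1F , cong B e
    classify (inj₁ (ct refl e)) = 2F , _ , refl , e

  ¬hub-T : ∀ j u → ¬ Hub (T j u)
  ¬hub-T j u = few-neighbours⇒¬hub (s<s (s<s (s<s z<s))) Class unique classify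
    where
    Class : Fin 3 → V → Set
    Class 0F y = y ≡ C j
    Class 1F y = TailAt j (suc (toℕ u)) y
    Class 2F y = TailAt j (pred (toℕ u)) y
    unique : ∀ l {y y′} → Class l y → Class l y′ → y ≡ y′
    unique 0F = ≡-unique
    unique 1F = tailAt-unique
    unique 2F = tailAt-unique
    classify : ∀ {y} → Adj (T j u) y → ∃ λ l → Class l y
    classify (inj₂ (ct e _))    = 0F , cong C e
    classify (inj₁ (tt refl e)) = 1F , _ , refl , e
    classify (inj₂ (tt refl e)) = 2F , _ , refl , cong pred (sym e)

  EndNeighbour : V → Set
  EndNeighbour y = (∃ λ i → y ≡ B i) ⊎ PathAt 1 y

  P₀-neighbour : ∀ {x y} → toℕ x ≡ 0 → Adj (P x) y → EndNeighbour y
  P₀-neighbour x≡0 (inj₁ (pp e)) = inj₂ (_ , refl , trans e (cong suc x≡0))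
  P₀-neighbour x≡0 (inj₂ (bp _)) = inj₁ (_ , refl)
  P₀-neighbour x≡0 (inj₂ (pp e)) = contradiction (trans (sym x≡0) e) 0≢1+n

  P₀-neighbours-nonadjacent : ∀ {y y′} → EndNeighbour y → EndNeighbour y′ → ¬ Adj y y′
  P₀-neighbours-nonadjacent (inj₁ (_ , refl)) (inj₁ (_ , refl)) (inj₁ ())
  P₀-neighbours-nonadjacent (inj₁ (_ , refl)) (inj₁ (_ , refl)) (inj₂ ())
  P₀-neighbours-nonadjacent (inj₁ (_ , refl)) (inj₂ (_ , refl , e)) (inj₁ (bp e′)) =
    0≢1+n (trans (sym e′) e)
  P₀-neighbours-nonadjacent (inj₂ (_ , refl , e)) (inj₁ (_ , refl)) (inj₂ (bp e′)) =
    0≢1+n (trans (sym e′) e)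
  P₀-neighbours-nonadjacent (inj₂ (_ , refl , e)) (inj₂ (_ , refl , e′)) (inj₁ (pp e″)) =
    1+n≢n (sym (trans (sym e′) (trans e″ (cong suc e))))
  P₀-neighbours-nonadjacent (inj₂ (_ , refl , e)) (inj₂ (_ , refl , e′)) (inj₂ (pp e″)) =
    1+n≢n (sym (trans (sym e) (trans e″ (cong suc e′))))

  ¬hub-P : ∀ x → ¬ Hub (P x)
  ¬hub-P x hub with toℕ x ≟ℕ 0
  ... | yes x≡0 = P₀-neighbours-nonadjacent (P₀-neighbour x≡0 (nbr-adj 0F))
                                            (P₀-neighbour x≡0 (nbr-adj 1F)) triangle
    where open Hub hub
  ... | no  x≢0 = few-neighbours⇒¬hub (s<s (s<s z<s)) Class unique classify hub
    where
    Class : Fin 2 → V → Set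
    Class 0F y = PathAt (suc (toℕ x)) y
    Class 1F y = PathAt (pred (toℕ x)) y
    unique : ∀ l {y y′} → Class l y → Class l y′ → y ≡ y′
    unique 0F = pathAt-unique
    unique 1F = pathAt-unique
    classify : ∀ {y} → Adj (P x) y → ∃ λ l → Class l y
    classify (inj₁ (pp e)) = 0F , _ , refl , e
    classify (inj₂ (pp e)) = 1F , _ , refl , cong pred (sym e)
    classify (inj₂ (bp e)) = contradiction e x≢0

  hub⇒cycle : ∀ {z} → Hub z → ∃ λ i → z ≡ A i
  hub⇒cycle {A i}   _   = i , refl
  hub⇒cycle {B i}   hub = contradiction hub (¬hub-B i)
  hub⇒cycle {C i}   hub = contradiction hub (¬hub-C i)
  hub⇒cycle {T i u} hub = contradiction hub (¬hub-T i u)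
  hub⇒cycle {P x}   hub = contradiction hub (¬hub-P x)

  -- Each cycle edge A i → A (s i) is oriented (apex B i, wing C i) …
  oriented-A : ∀ i → Oriented (A i) (A (s i))
  oriented-A i = record
    { apex = B i ; apex-x = inj₂ (ab refl) ; apex-y = inj₁ (ba refl) ; apex-¬hub = ¬hub-B i
    ; wing = C i ; wing-x = inj₂ (ac refl) ; wing-apex = inj₂ (bc refl) ; wing≢y = λ () }

  -- … but not backwards: for the edge A (s l) → A l the only possible apex is
  -- B l, and no wing exists.
  backward-apex : ∀ {l z} → Adj z (A (s l)) → Adj z (A l) → ¬ Hub z → z ≡ B l
  backward-apex (inj₁ (aa _)) _ ¬hub = contradiction (hub-A _) ¬hub
  backward-apex (inj₂ (aa _)) _ ¬hub = contradiction (hub-A _) ¬hub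
  backward-apex _ (inj₂ (ab refl)) _ = refl
  backward-apex {l} (inj₁ (ba e)) (inj₁ (ba e′)) _ = contradiction (trans (sym e) e′) (s-irrefl l)
  backward-apex {l} (inj₂ (ab e)) (inj₁ (ba e′)) _ = contradiction (trans (cong s e) e′) (ss-irrefl l)
  backward-apex {l} (inj₂ (ac e)) (inj₂ (ac e′)) _ = contradiction (trans e (sym e′)) (s-irrefl l)

  backward-wing : ∀ {l u} → Adj u (A (s l)) → Adj u (B l) → u ≢ A l → ⊥
  backward-wing a (inj₁ (ab refl)) u≢Al = u≢Al refl
  backward-wing a (inj₂ (ba refl)) _ = adj-irrefl a
  backward-wing {l} (inj₂ (ac e)) (inj₂ (bc e′)) _ = s-irrefl l (trans e (sym e′))
  backward-wing (inj₁ ()) (inj₂ (bp _)) _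
  backward-wing (inj₂ ()) (inj₂ (bp _)) _

  oriented⇒successor : ∀ {j l} → Adj (A j) (A l) → Oriented (A j) (A l) → l ≡ s j
  oriented⇒successor (inj₁ (aa e))    _ = sym e
  oriented⇒successor {l = l} (inj₂ (aa refl)) o =
    ⊥-elim (backward-wing wing-x (subst (Adj wing) apex≡B wing-apex) wing≢y)
    where
    open Oriented o
    apex≡B : apex ≡ B l
    apex≡B = backward-apex apex-x apex-y apex-¬hub

  -- Every automorphism is a rotation: k is read off from the image of A 0.
  module Rigidity (π : Perm V) (aut : IsAut graph π) where
    open Automorphism π aut

    start : ∃ λ k → f (A 0F) ≡ A k
    start = hub⇒cycle (hub-f (hub-A 0F))

    k : Fin n
    k = proj₁ start

    open Agreement _≟V_ (rot k) (rot (⊖ k)) (rot-reflects k) (rot⁻¹-cancel k)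

    -- f maps A (s i) to the successor of f (A i), since it maps hubs to hubs
    -- and oriented edges to oriented edges.
    agree-A : ∀ i → Agrees (A i)
    agree-A = cycle-induction (Agrees ∘ A) (trans (proj₂ start) (cong A (sym (⊕-identityˡ k)))) step
      where
      step : ∀ i → Agrees (A i) → Agrees (A (s i))
      step i ag with hub⇒cycle (hub-f (hub-A (s i)))
      ... | l , fAsi≡Al = trans fAsi≡Al (cong A (trans successor (s-⊕ i k)))
        where
        successor : l ≡ s (i ⊕ k)
        successor = oriented⇒successor
          (subst₂ Adj ag fAsi≡Al (preserves (inj₁ (aa refl))))
          (subst₂ Oriented ag fAsi≡Al (oriented-f (oriented-A i)))

    -- B i is the only common neighbour of A i and A (s i) besides cycle vertices.
    agree-B : ∀ i → Agrees (B i)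
    agree-B i = spread (agree-A i) (agree-A (s i)) (inj₁ (ab refl)) (inj₂ (ba refl)) others
      where
      others : ∀ {x} → Adj (A i) x → Adj (A (s i)) x → x ≢ B i → Agrees x
      others (inj₁ (aa _)) _ _ = agree-A _
      others (inj₂ (aa _)) _ _ = agree-A _
      others (inj₁ (ab refl)) _ x≢Bi = contradiction refl x≢Bi
      others (inj₂ (ba e)) (inj₁ (ab e′)) _ = contradiction (trans (cong s e) e′) (ss-irrefl _)
      others (inj₂ (ba e)) (inj₂ (ba e′)) _ = contradiction (trans (sym e′) e) (s-irrefl i)
      others (inj₁ (ac e)) (inj₁ (ac e′)) _ = contradiction (trans e′ (sym e)) (s-irrefl i)

    -- C i is the only common neighbour of A i and B i besides cycle vertices.
    agree-C : ∀ i → Agrees (C i)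
    agree-C i = spread (agree-A i) (agree-B i) (inj₁ (ac refl)) (inj₁ (bc refl)) others
      where
      others : ∀ {x} → Adj (A i) x → Adj (B i) x → x ≢ C i → Agrees x
      others _ (inj₁ (ba _)) _ = agree-A _
      others _ (inj₂ (ab _)) _ = agree-A _
      others _ (inj₁ (bc refl)) x≢Ci = contradiction refl x≢Ci
      others (inj₁ ()) (inj₁ (bp _)) _
      others (inj₂ ()) (inj₁ (bp _)) _

    agree-T : ∀ i u → Agrees (T i u)
    agree-T i = path-induction (Agrees ∘ T i) first next
      where
      first : ∀ u → toℕ u ≡ 0 → Agrees (T i u)
      first u u≡0 = spread₁ (agree-C i) (inj₁ (ct refl u≡0)) others
        where
        others : ∀ {x} → Adj (C i) x → x ≢ T i u → Agrees x
        others (inj₂ (ac _)) _ = agree-A _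
        others (inj₂ (bc _)) _ = agree-B _
        others (inj₁ (ct refl e)) x≢T =
          contradiction (cong (T i) (toℕ-injective (trans e (sym u≡0)))) x≢T
      next : ∀ u v → toℕ v ≡ suc (toℕ u) → (∀ w → toℕ w ≤ toℕ u → Agrees (T i w)) → Agrees (T i v)
      next u v e ih = spread₁ (ih u ≤-refl) (inj₁ (tt refl e)) others
        where
        others : ∀ {x} → Adj (T i u) x → x ≢ T i v → Agrees x
        others (inj₂ (ct _ _)) _ = agree-C _
        others (inj₁ (tt refl e′)) x≢T =
          contradiction (cong (T i) (toℕ-injective (trans e′ (sym e)))) x≢T
        others (inj₂ (tt {u = w} refl e′)) _ = ih w (subst (toℕ w ≤_) (sym e′) (n≤1+n (toℕ w)))

    agree-P : ∀ x → Agrees (P x)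
    agree-P = path-induction (Agrees ∘ P) first next
      where
      first : ∀ x → toℕ x ≡ 0 → Agrees (P x)
      first x x≡0 = spread₁ (agree-B 0F) (inj₁ (bp x≡0)) others
        where
        others : ∀ {y} → Adj (B 0F) y → y ≢ P x → Agrees y
        others (inj₁ (ba _)) _ = agree-A _
        others (inj₂ (ab _)) _ = agree-A _
        others (inj₁ (bc _)) _ = agree-C _
        others (inj₁ (bp e)) y≢P =
          contradiction (cong P (toℕ-injective (trans e (sym x≡0)))) y≢P
      next : ∀ x y → toℕ y ≡ suc (toℕ x) → (∀ w → toℕ w ≤ toℕ x → Agrees (P w)) → Agrees (P y)
      next x y e ih = spread₁ (ih x ≤-refl) (inj₁ (pp e)) others
        where
        others : ∀ {z} → Adj (P x) z → z ≢ P y → Agrees z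
        others (inj₂ (bp _)) _ = agree-B _
        others (inj₁ (pp e′)) z≢P =
          contradiction (cong P (toℕ-injective (trans e′ (sym e)))) z≢P
        others (inj₂ (pp {x = w} e′)) _ = ih w (subst (toℕ w ≤_) (sym e′) (n≤1+n (toℕ w)))

    agree : ∀ v → Agrees v
    agree (A i)   = agree-A i
    agree (B i)   = agree-B i
    agree (C i)   = agree-C i
    agree (T i u) = agree-T i u
    agree (P x)   = agree-P x

  aut⇒rotation : ∀ π → IsAut graph π → CnrIm n R m π
  aut⇒rotation π aut = Rigidity.k π aut , Rigidity.agree π aut

corollary3p8 : (r n m : ℕ) → 2 < r → 3 ≤ n → GR 2 (CnrIm n r m)
corollary3p8 (suc (suc (suc r′))) (suc (suc (suc n′))) m (s≤s (s≤s (s≤s z≤n))) (s≤s (s≤s (s≤s z≤n))) =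
  graph , λ π → aut⇒rotation π , rotation⇒aut π
  where open Construction n′ r′ m
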